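{- Let $G$ be a connected graph of order $n\geq 3$, let $G_1,G_2$ be disjoint copies of $G$ with $A=V(G_1)$, $B=V(G_2)$, and let $g:A\rightarrow B$ be any function. Then $0\leq fix(F_G)\leq 2n-3$. Both bounds are sharp: there exist a connected graph $G$ of order at least $3$ and a function $g$ with $fix(F_G)=0$, and there exist a connected graph $G$ of order $n\ge 3$ and a function $g$ with $fix(F_G)=2n-3$.
   Context: All graphs are finite and simple. For a graph $H$, $\Gamma(H)$ denotes its automorphism group. A set $S\subseteq V(H)$ is a fixing set of $H$ if the only automorphism of $H$ fixing every vertex of $S$ is the identity; the fixing number $fix(H)$ is the minimum cardinality of a fixing set of $H$. Functigraph: given a graph $G$, let $G_1$ and $G_2$ be disjoint copies of $G$, $A=V(G_1)$, $B=V(G_2)$, and $g:A\to B$ a function; the functigraph $F_G$ is the graph with vertex set $A\cup B$ and edge set $E(G_1)\cup E(G_2)\cup\{uv: u\in A,\ v=g(u)\}$. -}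

module Defs where

open import Data.Nat using (ℕ)
open import Data.Bool using (Bool; true; false)
open import Data.Fin using (Fin)
open import Data.Fin.Properties using (_≟_)
open import Data.Sum using (_⊎_; inj₁; inj₂)
open import Data.List using (List; length)
open import Data.List.Membership.Propositional using (_∈_)
open import Data.Product using (Σ; _×_; _,_)
open import Relation.Nullary.Decidable using (⌊_⌋)
open import Relation.Binary.PropositionalEquality using (_≡_; refl)
open import Function.Bundles using (_↔_; Inverse)

record Graph (V : Set) : Set where
  field
    Adj    : V → V → Bool
    sym    : ∀ u v → Adj u v ≡ Adj v u
    irrefl : ∀ v → Adj v v ≡ false
open Graph public

Graphₙ : ℕ → Set
Graphₙ n = Graph (Fin n)

data Reachable {V : Set} (H : Graph V) : V → V → Set where
  here : ∀ {v} → Reachable H v v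
  step : ∀ {u w v} → Adj H u w ≡ true → Reachable H w v → Reachable H u v

Connected : {V : Set} → Graph V → Set
Connected {V} H = ∀ (u v : V) → Reachable H u v

record Automorphism {V : Set} (H : Graph V) : Set where
  field
    perm     : V ↔ V
    preserve : ∀ u v → Adj H (Inverse.to perm u) (Inverse.to perm v) ≡ Adj H u v
open Automorphism public

IsFixingSet : {V : Set} → Graph V → List V → Set
IsFixingSet {V} H S =
  (σ : Automorphism H) → (∀ s → s ∈ S → Inverse.to (perm σ) s ≡ s) →
  ∀ (v : V) → Inverse.to (perm σ) v ≡ v

-- fix(H) = k : k is the minimum cardinality of a fixing set.
-- (Lists may contain duplicates, but a duplicate-free list of the same
-- vertices is also fixing and shorter, so the minimum is over sets.)
IsFixingNumber : {V : Set} → Graph V → ℕ → Set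
IsFixingNumber {V} H k =
  Σ (List V) (λ S → IsFixingSet H S × length S ≡ k)
  × (∀ (S : List V) → IsFixingSet H S → k Data.Nat.≤ length S)

-- Functigraph F_G: A = inj₁ (copy G₁), B = inj₂ (copy G₂), g : A → B
-- (identified with a function Fin n → Fin n), extra edges u — g(u).
funcAdj : {n : ℕ} → Graphₙ n → (Fin n → Fin n) → Fin n ⊎ Fin n → Fin n ⊎ Fin n → Bool
funcAdj G g (inj₁ a) (inj₁ b) = Adj G a b
funcAdj G g (inj₂ a) (inj₂ b) = Adj G a b
funcAdj G g (inj₁ a) (inj₂ b) = ⌊ b ≟ g a ⌋
funcAdj G g (inj₂ b) (inj₁ a) = ⌊ b ≟ g a ⌋

funcSym : {n : ℕ} (G : Graphₙ n) (g : Fin n → Fin n) → ∀ u v → funcAdj G g u v ≡ funcAdj G g v u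
funcSym G g (inj₁ a) (inj₁ b) = sym G a b
funcSym G g (inj₂ a) (inj₂ b) = sym G a b
funcSym G g (inj₁ a) (inj₂ b) = refl
funcSym G g (inj₂ b) (inj₁ a) = refl

funcIrrefl : {n : ℕ} (G : Graphₙ n) (g : Fin n → Fin n) → ∀ v → funcAdj G g v v ≡ false
funcIrrefl G g (inj₁ a) = irrefl G a
funcIrrefl G g (inj₂ a) = irrefl G a

Functigraph : {n : ℕ} → Graphₙ n → (Fin n → Fin n) → Graph (Fin n ⊎ Fin n)
Functigraph G g = record { Adj = funcAdj G g ; sym = funcSym G g ; irrefl = funcIrrefl G g }

module Submission where

-- If x, y, z are pairwise non-twins (each pair is separated by a third
-- vertex), an automorphism fixing every vertex outside {x, y, z} is the identity: it
-- permutes the triple, a fixed separator excludes sending one of them to another, and a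
-- 3-cycle is excluded by the adjacencies it would force (TripleRigidity).  In F_G the
-- vertices a ∈ A, g a ∈ B and a suitable c ∈ B form such a triple (UpperBound), so the
-- other 2n − 3 vertices form a fixing set.  On a finite graph "S is a fixing set" is
-- decidable, by exhaustive search over pairs of mutually inverse maps (FiniteGraph), so a
-- smallest fixing set exists: the fixing number exists and is at most 2n − 3.
--
-- For the path on three vertices with g = (0 ↦ 0, 1 ↦ 1, 2 ↦ 1), F_G is
-- rigid: its unique leaf, the leaf's neighbour and a vertex determined by its adjacencies
-- to these two are fixed, and the remaining three vertices are pairwise non-twins.  For
-- the triangle with constant g, exchanging two twins is an automorphism, so every fixing
-- set meets every twin pair and needs 3 = 2·3 − 3 elements.

open import Defs hiding (sym)
open import Data.Nat using (ℕ; zero; suc; _≤_; _<_; _∸_; _*_; _+_; z≤n; s≤s)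
import Data.Nat as ℕ
open import Data.Nat.Properties
  using (≤-refl; ≤-trans; <⇒≤; ≮⇒≥; ≤-antisym; anyUpTo?; ∸-monoˡ-≤; +-identityʳ; 1+n≢n; m≤m+n)
open import Data.Nat.Induction using (<-rec)
open import Data.Fin using (Fin; zero; suc; toℕ; punchIn; punchOut)
import Data.Fin.Properties as Finₚ
open import Data.Fin.Properties using (any?; +↔⊎; punchInᵢ≢i; punchIn-injective; punchIn-punchOut)
open import Data.Vec using (Vec; []; _∷_)
import Data.Vec as Vec
import Data.Vec.Properties as Vecₚ
open import Data.List using (List; []; _∷_; length; filter)
import Data.List as List
open import Data.List.Properties using (filter-notAll; length-tabulate)
open import Data.List.Relation.Unary.Any as Any using (here; there)
open import Data.List.Relation.Unary.All as All using (All; []; _∷_)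
open import Data.List.Membership.Propositional using (_∈_; _∉_)
open import Data.List.Membership.Propositional.Properties using (∈-filter⁺; ∈-tabulate⁺)
open import Data.Bool using (Bool; true; false; not; _∨_)
import Data.Bool.Properties as Bool
open import Data.Sum using (_⊎_; inj₁; inj₂; [_,_]′)
import Data.Sum.Properties as Sumₚ
open import Data.Sum.Properties using (inj₁-injective; inj₂-injective)
open import Data.Product using (Σ; ∃; _×_; _,_; proj₁; proj₂)
open import Data.Empty using (⊥; ⊥-elim)
open import Function using (_∘_)
open import Function.Bundles using (_↔_; Inverse; mk↔ₛ′)
open import Function.Properties.Inverse using (↔-sym)
open import Relation.Nullary using (Dec; yes; no; ¬_; ¬?)
open import Relation.Nullary.Decidable
  using (map′; decidable-stable; _×-dec_; dec-true; dec-false; ⌊_⌋; isYes≗does)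
import Relation.Unary as U
open import Relation.Binary.Definitions using (DecidableEquality)
open import Relation.Binary.PropositionalEquality
  using (_≡_; _≢_; refl; sym; trans; cong; cong₂; subst; ≢-sym; module ≡-Reasoning)
open ≡-Reasoning

Searchable : Set → Set₁
Searchable A = {P : A → Set} → U.Decidable P → Dec (∃ P)

search-↔ : {A B : Set} → A ↔ B → Searchable B → Searchable A
search-↔ e searchB {P} P? =
  map′ (λ (b , p) → Inverse.from e b , p)
       (λ (a , p) → Inverse.to e a , subst P (sym (Inverse.strictlyInverseʳ e a)) p)
       (searchB (P? ∘ Inverse.from e))

search-Vec : {B : Set} → Searchable B → ∀ m → Searchable (Vec B m)
search-Vec searchB zero    P? = map′ ([] ,_) (λ { ([] , p) → p }) (P? [])
search-Vec searchB (suc m) P? =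
  map′ (λ (b , bs , p) → b ∷ bs , p) (λ { (b ∷ bs , p) → b , bs , p })
       (searchB (λ b → search-Vec searchB m (λ bs → P? (b ∷ bs))))

all-of : {A : Set} → Searchable A → {P : A → Set} → U.Decidable P → Dec (∀ a → P a)
all-of search P? =
  map′ (λ none a → decidable-stable (P? a) (λ ¬p → none (a , ¬p)))
       (λ all (a , ¬p) → ¬p (all a))
       (¬? (search (¬? ∘ P?)))

minimal-witness : {P : ℕ → Set} → U.Decidable P → ∀ m → P m →
                  ∃ λ k → P k × k ≤ m × (∀ j → P j → k ≤ j)
minimal-witness {P} P? = <-rec Goal descend
  where
  Goal : ℕ → Set
  Goal m = P m → ∃ λ k → P k × k ≤ m × (∀ j → P j → k ≤ j)

  descend : ∀ m → (∀ {j} → j < m → Goal j) → Goal m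
  descend m smaller pm with anyUpTo? P? m
  ... | yes (j , j<m , pj) =
        let (k , pk , k≤j , least) = smaller j<m pj in k , pk , ≤-trans k≤j (<⇒≤ j<m) , least
  ... | no none = m , pm , ≤-refl , λ j pj → ≮⇒≥ (λ j<m → none (j , j<m , pj))

avoid-two : ∀ {m} (b c : Fin (3 + m)) → ∃ λ v → v ≢ b × v ≢ c
avoid-two b c with b Finₚ.≟ c
... | yes refl = punchIn b zero , punchInᵢ≢i b zero , punchInᵢ≢i b zero
... | no b≢c   = punchIn b (punchIn (punchOut b≢c) zero) , punchInᵢ≢i b _ , v≢c
  where
  -- c = punchIn b (punchOut b≢c), and punchIn is injective and avoids its pivot.
  v≢c : punchIn b (punchIn (punchOut b≢c) zero) ≢ c
  v≢c v≡c = punchInᵢ≢i (punchOut b≢c) zero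
    (punchIn-injective b _ _ (trans v≡c (sym (punchIn-punchOut b≢c))))

module Deletion {A : Set} (_≟_ : DecidableEquality A) where

  infixl 5 _without_
  _without_ : List A → A → List A
  xs without u = filter (λ v → ¬? (v ≟ u)) xs

  length-without : ∀ {u xs} → u ∈ xs → length (xs without u) < length xs
  length-without {u} {xs} u∈xs =
    filter-notAll (λ v → ¬? (v ≟ u)) xs (Any.map (λ v≡u v≢u → v≢u (sym v≡u)) u∈xs)

  ∈-without : ∀ {u v xs} → v ∈ xs → v ≢ u → v ∈ xs without u
  ∈-without {u} v∈xs v≢u = ∈-filter⁺ (λ v → ¬? (v ≟ u)) v∈xs v≢u

  length-without₃ : ∀ {p q r xs} → p ≢ q → p ≢ r → q ≢ r → p ∈ xs → q ∈ xs → r ∈ xs →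
                    3 + length (xs without p without q without r) ≤ length xs
  length-without₃ {p} {q} {r} {xs} p≢q p≢r q≢r p∈ q∈ r∈ =
    ≤-trans (s≤s (s≤s shorter-r)) (≤-trans (s≤s shorter-q) shorter-p)
    where
    shorter-p : length (xs without p) < length xs
    shorter-p = length-without p∈
    shorter-q : length (xs without p without q) < length (xs without p)
    shorter-q = length-without (∈-without q∈ (≢-sym p≢q))
    shorter-r : length (xs without p without q without r) < length (xs without p without q)
    shorter-r = length-without (∈-without (∈-without r∈ (≢-sym p≢r)) (≢-sym q≢r))

⌊⌋-yes : ∀ {A : Set} (a? : Dec A) → A → ⌊ a? ⌋ ≡ true
⌊⌋-yes a? a = trans (isYes≗does a?) (dec-true a? a)

⌊⌋-no : ∀ {A : Set} (a? : Dec A) → ¬ A → ⌊ a? ⌋ ≡ false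
⌊⌋-no a? ¬a = trans (isYes≗does a?) (dec-false a? ¬a)

true≢false-at : ∀ {b b′ : Bool} → b ≡ true → b′ ≡ false → b ≢ b′
true≢false-at refl refl ()

Twins : {V : Set} → Graph V → V → V → Set
Twins H p q = ∀ w → w ≢ p → w ≢ q → Adj H p w ≡ Adj H q w

NonTwins : {V : Set} → Graph V → V → V → Set
NonTwins H p q = ∃ λ w → w ≢ p × w ≢ q × Adj H p w ≢ Adj H q w

NonTwins-sym : ∀ {V} (H : Graph V) {p q} → NonTwins H p q → NonTwins H q p
NonTwins-sym H (w , w≢p , w≢q , separates) = w , w≢q , w≢p , separates ∘ sym

IsLeafAt : {V : Set} → Graph V → V → V → Set
IsLeafAt H u w = Adj H u w ≡ true × (∀ w′ → Adj H u w′ ≡ true → w′ ≡ w)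

not-leaf : ∀ {V} (H : Graph V) u {p q w} → Adj H u p ≡ true → Adj H u q ≡ true → p ≢ q →
           ¬ IsLeafAt H u w
not-leaf H u {p} {q} u~p u~q p≢q (_ , only-w) = p≢q (trans (only-w p u~p) (sym (only-w q u~q)))

adjacent-distinct : ∀ {V} (H : Graph V) {u w} → Adj H u w ≡ true → u ≢ w
adjacent-distinct H {u} u~u refl with trans (sym u~u) (irrefl H u)
... | ()

first-step : ∀ {V} {H : Graph V} {u v} → Reachable H u v → u ≢ v → ∃ λ w → Adj H u w ≡ true
first-step here         u≢u = ⊥-elim (u≢u refl)
first-step (step u~w _) _   = _ , u~w

hub-connected : ∀ {V} (H : Graph V) (h : V) → (∀ v → v ≡ h ⊎ Adj H v h ≡ true) → Connected H
hub-connected H h spoke u v = to-hub (spoke u) (from-hub (spoke v))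
  where
  from-hub : ∀ {v} → v ≡ h ⊎ Adj H v h ≡ true → Reachable H h v
  from-hub (inj₁ refl)    = here
  from-hub {v} (inj₂ v~h) = step (trans (Graph.sym H h v) v~h) here
  to-hub : ∀ {u} → u ≡ h ⊎ Adj H u h ≡ true → Reachable H h v → Reachable H u v
  to-hub (inj₁ refl) walk = walk
  to-hub (inj₂ u~h)  walk = step u~h walk

module AutomorphismFacts {V : Set} {H : Graph V} (σ : Automorphism H) where

  σ̂ σ⁻¹ : V → V
  σ̂   = Inverse.to (perm σ)
  σ⁻¹ = Inverse.from (perm σ)

  σ⁻¹-σ : ∀ v → σ⁻¹ (σ̂ v) ≡ v
  σ⁻¹-σ = Inverse.strictlyInverseʳ (perm σ)

  σ-σ⁻¹ : ∀ v → σ̂ (σ⁻¹ v) ≡ v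
  σ-σ⁻¹ = Inverse.strictlyInverseˡ (perm σ)

  σ-injective : ∀ {u v} → σ̂ u ≡ σ̂ v → u ≡ v
  σ-injective {u} {v} σu≡σv = trans (sym (σ⁻¹-σ u)) (trans (cong σ⁻¹ σu≡σv) (σ⁻¹-σ v))

  adj-to-fixed : ∀ {u w} → σ̂ w ≡ w → Adj H (σ̂ u) w ≡ Adj H u w
  adj-to-fixed {u} {w} σw≡w = trans (cong (Adj H (σ̂ u)) (sym σw≡w)) (preserve σ u w)

  fixed-separator : ∀ {p q w} → σ̂ p ≡ q → σ̂ w ≡ w → Adj H p w ≢ Adj H q w → ⊥
  fixed-separator {p} {q} {w} σp≡q σw≡w separates =
    separates (trans (sym (adj-to-fixed σw≡w)) (cong (λ t → Adj H t w) σp≡q))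

  leaf-image : ∀ {u w} → IsLeafAt H u w → IsLeafAt H (σ̂ u) (σ̂ w)
  leaf-image {u} {w} (u~w , only-w) = trans (preserve σ u w) u~w , only-σw
    where
    only-σw : ∀ w′ → Adj H (σ̂ u) w′ ≡ true → w′ ≡ σ̂ w
    only-σw w′ σu~w′ = begin
      w′             ≡⟨ sym (σ-σ⁻¹ w′) ⟩
      σ̂ (σ⁻¹ w′)     ≡⟨ cong σ̂ (only-w (σ⁻¹ w′) u~σ⁻¹w′) ⟩
      σ̂ w            ∎
      where
      u~σ⁻¹w′ : Adj H u (σ⁻¹ w′) ≡ true
      u~σ⁻¹w′ = begin
        Adj H u (σ⁻¹ w′)              ≡⟨ sym (preserve σ u (σ⁻¹ w′)) ⟩
        Adj H (σ̂ u) (σ̂ (σ⁻¹ w′))      ≡⟨ cong (Adj H (σ̂ u)) (σ-σ⁻¹ w′) ⟩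
        Adj H (σ̂ u) w′                ≡⟨ σu~w′ ⟩
        true                          ∎

  unique-leaf-fixed : ∀ {ℓ w} → IsLeafAt H ℓ w → (∀ u u′ → IsLeafAt H u u′ → u ≡ ℓ) →
                      σ̂ ℓ ≡ ℓ × σ̂ w ≡ w
  unique-leaf-fixed {ℓ} {w} leaf only-leaf = σℓ≡ℓ , proj₂ leaf (σ̂ w) ℓ~σw
    where
    σℓ≡ℓ : σ̂ ℓ ≡ ℓ
    σℓ≡ℓ = only-leaf (σ̂ ℓ) (σ̂ w) (leaf-image leaf)
    ℓ~σw : Adj H ℓ (σ̂ w) ≡ true
    ℓ~σw = subst (λ t → Adj H t (σ̂ w) ≡ true) σℓ≡ℓ (proj₁ (leaf-image leaf))

  determined-fixed : ∀ (X : List V) {v} → (∀ {x} → x ∈ X → σ̂ x ≡ x) → v ∉ X →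
                     (∀ w → w ∉ X → All (λ x → Adj H w x ≡ Adj H v x) X → w ≡ v) →
                     σ̂ v ≡ v
  determined-fixed X {v} fixes-X v∉X determined =
    determined (σ̂ v) σv∉X (All.tabulate (λ x∈X → adj-to-fixed (fixes-X x∈X)))
    where
    σv∉X : σ̂ v ∉ X
    σv∉X σv∈X = v∉X (subst (_∈ X) (σ-injective (fixes-X σv∈X)) σv∈X)

module TripleRigidity {V : Set} (_≟_ : DecidableEquality V) {H : Graph V} (σ : Automorphism H) where
  open AutomorphismFacts σ

  In3 : V → V → V → V → Set
  In3 p q r v = v ≡ p ⊎ v ≡ q ⊎ v ≡ r

  FixesOutside : V → V → V → Set
  FixesOutside p q r = ∀ v → v ≢ p → v ≢ q → v ≢ r → σ̂ v ≡ v

  -- σ permutes {p, q, r}: an image outside the triple would be fixed, hence equal to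
  -- its preimage by injectivity.
  stays-in-triple : ∀ {p q r v} → FixesOutside p q r → In3 p q r v → In3 p q r (σ̂ v)
  stays-in-triple {p} {q} {r} {v} fixes v∈T
    with σ̂ v ≟ p | σ̂ v ≟ q | σ̂ v ≟ r
  ... | yes σv≡p | _        | _        = inj₁ σv≡p
  ... | no _     | yes σv≡q | _        = inj₂ (inj₁ σv≡q)
  ... | no _     | no _     | yes σv≡r = inj₂ (inj₂ σv≡r)
  ... | no σv≢p  | no σv≢q  | no σv≢r  =
        ⊥-elim ([ σv≢p , [ σv≢q , σv≢r ]′ ]′ (subst (In3 p q r) (sym σv≡v) v∈T))
    where
    σv≡v : σ̂ v ≡ v
    σv≡v = σ-injective (fixes (σ̂ v) σv≢p σv≢q σv≢r)

  -- If r separates p from q, σ cannot send p to q: σ would have to be the 3-cycle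
  -- p ↦ q ↦ r ↦ p, and then Adj p r = Adj r p = Adj (σ q) (σ r) = Adj q r.
  third-separator : ∀ {p q r} → p ≢ q → q ≢ r → p ≢ r → FixesOutside p q r →
                    σ̂ p ≡ q → Adj H p r ≢ Adj H q r → ⊥
  third-separator {p} {q} {r} p≢q q≢r p≢r fixes σp≡q separates
    with stays-in-triple fixes (inj₂ (inj₂ refl))
  ... | inj₂ (inj₁ σr≡q) = p≢r (σ-injective (trans σp≡q (sym σr≡q)))
  ... | inj₂ (inj₂ σr≡r) = fixed-separator σp≡q σr≡r separates
  ... | inj₁ σr≡p with stays-in-triple fixes (inj₂ (inj₁ refl))
  ...   | inj₁ σq≡p        = q≢r (σ-injective (trans σq≡p (sym σr≡p)))
  ...   | inj₂ (inj₁ σq≡q) = p≢q (σ-injective (trans σp≡q (sym σq≡q)))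
  ...   | inj₂ (inj₂ σq≡r) = separates (begin
          Adj H p r              ≡⟨ Graph.sym H p r ⟩
          Adj H r p              ≡⟨ cong₂ (Adj H) (sym σq≡r) (sym σr≡p) ⟩
          Adj H (σ̂ q) (σ̂ r)      ≡⟨ preserve σ q r ⟩
          Adj H q r              ∎)

  no-move : ∀ {p q r} → p ≢ q → q ≢ r → p ≢ r → FixesOutside p q r →
            σ̂ p ≡ q → NonTwins H p q → ⊥
  no-move {r = r} p≢q q≢r p≢r fixes σp≡q (w , w≢p , w≢q , separates) with w ≟ r
  ... | yes refl = third-separator p≢q q≢r p≢r fixes σp≡q separates
  ... | no w≢r   = fixed-separator σp≡q (fixes w w≢p w≢q w≢r) separates

  -- Each vertex of the triple stays in the triple, and moving it to another one is
  -- excluded by no-move, applied to the triple listed in the appropriate order.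
  triple-rigid : ∀ {x y z} → x ≢ y → y ≢ z → x ≢ z →
                 NonTwins H x y → NonTwins H x z → NonTwins H y z →
                 FixesOutside x y z → ∀ v → σ̂ v ≡ v
  triple-rigid {x} {y} {z} x≢y y≢z x≢z xy xz yz fixes v
    with v ≟ x | v ≟ y | v ≟ z
  ... | no v≢x | no v≢y | no v≢z = fixes v v≢x v≢y v≢z
  ... | yes refl | _ | _ with stays-in-triple fixes (inj₁ refl)
  ...   | inj₁ σx≡x        = σx≡x
  ...   | inj₂ (inj₁ σx≡y) = ⊥-elim (no-move x≢y y≢z x≢z fixes σx≡y xy)
  ...   | inj₂ (inj₂ σx≡z) = ⊥-elim (no-move x≢z (≢-sym y≢z) x≢y
                                       (λ u u≢x u≢z u≢y → fixes u u≢x u≢y u≢z) σx≡z xz)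
  triple-rigid {x} {y} {z} x≢y y≢z x≢z xy xz yz fixes v
    | no _ | yes refl | _ with stays-in-triple fixes (inj₂ (inj₁ refl))
  ...   | inj₂ (inj₁ σy≡y) = σy≡y
  ...   | inj₁ σy≡x        = ⊥-elim (no-move (≢-sym x≢y) x≢z y≢z
                                       (λ u u≢y u≢x u≢z → fixes u u≢x u≢y u≢z) σy≡x (NonTwins-sym H xy))
  ...   | inj₂ (inj₂ σy≡z) = ⊥-elim (no-move y≢z (≢-sym x≢z) (≢-sym x≢y)
                                       (λ u u≢y u≢z u≢x → fixes u u≢x u≢y u≢z) σy≡z yz)
  triple-rigid {x} {y} {z} x≢y y≢z x≢z xy xz yz fixes v
    | no _ | no _ | yes refl with stays-in-triple fixes (inj₂ (inj₂ refl))
  ...   | inj₂ (inj₂ σz≡z) = σz≡z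
  ...   | inj₁ σz≡x        = ⊥-elim (no-move (≢-sym x≢z) x≢y (≢-sym y≢z)
                                       (λ u u≢z u≢x u≢y → fixes u u≢x u≢y u≢z) σz≡x (NonTwins-sym H xz))
  ...   | inj₂ (inj₁ σz≡y) = ⊥-elim (no-move (≢-sym y≢z) (≢-sym x≢y) (≢-sym x≢z)
                                       (λ u u≢z u≢y u≢x → fixes u u≢x u≢y u≢z) σz≡y (NonTwins-sym H yz))

module TwinTransposition {V : Set} (_≟_ : DecidableEquality V) (H : Graph V)
                         {p q : V} (p≢q : p ≢ q) (twins : Twins H p q) where
  open import Data.List.Membership.DecPropositional _≟_ using (_∈?_)

  data Place (v : V) : Set where
    at-p      : v ≡ p → Place v
    at-q      : v ≡ q → Place v
    elsewhere : v ≢ p → v ≢ q → Place v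

  place : ∀ v → Place v
  place v with v ≟ p | v ≟ q
  ... | yes v≡p | _       = at-p v≡p
  ... | no _    | yes v≡q = at-q v≡q
  ... | no v≢p  | no v≢q  = elsewhere v≢p v≢q

  swap : V → V
  swap v with place v
  ... | at-p _        = q
  ... | at-q _        = p
  ... | elsewhere _ _ = v

  swap-p : swap p ≡ q
  swap-p with place p
  ... | at-p _          = refl
  ... | at-q p≡q        = ⊥-elim (p≢q p≡q)
  ... | elsewhere p≢p _ = ⊥-elim (p≢p refl)

  swap-q : swap q ≡ p
  swap-q with place q
  ... | at-p q≡p        = ⊥-elim (p≢q (sym q≡p))
  ... | at-q _          = refl
  ... | elsewhere _ q≢q = ⊥-elim (q≢q refl)

  swap-other : ∀ {v} → v ≢ p → v ≢ q → swap v ≡ v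
  swap-other {v} v≢p v≢q with place v
  ... | at-p v≡p      = ⊥-elim (v≢p v≡p)
  ... | at-q v≡q      = ⊥-elim (v≢q v≡q)
  ... | elsewhere _ _ = refl

  swap-involutive : ∀ v → swap (swap v) ≡ v
  swap-involutive v with place v
  ... | at-p refl         = swap-q
  ... | at-q refl         = swap-p
  ... | elsewhere v≢p v≢q = swap-other v≢p v≢q

  swap-preserves : ∀ u v → Adj H (swap u) (swap v) ≡ Adj H u v
  swap-preserves u v with place u | place v
  ... | at-p refl         | at-p refl         = trans (irrefl H q) (sym (irrefl H p))
  ... | at-p refl         | at-q refl         = Graph.sym H q p
  ... | at-p refl         | elsewhere v≢p v≢q = sym (twins v v≢p v≢q)
  ... | at-q refl         | at-p refl         = Graph.sym H p q
  ... | at-q refl         | at-q refl         = trans (irrefl H p) (sym (irrefl H q))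
  ... | at-q refl         | elsewhere v≢p v≢q = twins v v≢p v≢q
  ... | elsewhere u≢p u≢q | at-p refl         =
        trans (Graph.sym H u q) (trans (sym (twins u u≢p u≢q)) (Graph.sym H p u))
  ... | elsewhere u≢p u≢q | at-q refl         =
        trans (Graph.sym H u p) (trans (twins u u≢p u≢q) (Graph.sym H q u))
  ... | elsewhere _ _     | elsewhere _ _     = refl

  transposition : Automorphism H
  transposition = record
    { perm     = mk↔ₛ′ swap swap swap-involutive swap-involutive
    ; preserve = swap-preserves
    }

  -- A set avoiding both twins is fixed pointwise by the transposition, which moves p.
  fixing-set-meets-twins : ∀ {S} → IsFixingSet H S → p ∈ S ⊎ q ∈ S
  fixing-set-meets-twins {S} fixing with p ∈? S | q ∈? S
  ... | yes p∈S | _       = inj₁ p∈S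
  ... | no _    | yes q∈S = inj₂ q∈S
  ... | no p∉S  | no q∉S  =
        ⊥-elim (p≢q (trans (sym (fixing transposition avoids p)) swap-p))
    where
    avoids : ∀ s → s ∈ S → swap s ≡ s
    avoids s s∈S = swap-other (λ s≡p → p∉S (subst (_∈ S) s≡p s∈S))
                              (λ s≡q → q∉S (subst (_∈ S) s≡q s∈S))

module FiniteGraph {V : Set} (_≟_ : DecidableEquality V) {k : ℕ} (enum : V ↔ Fin k) where

  index : V → Fin k
  index = Inverse.to enum

  vertexAt : Fin k → V
  vertexAt = Inverse.from enum

  search-V : Searchable V
  search-V = search-↔ enum any?

  vertices : List V
  vertices = List.tabulate vertexAt

  ∈-vertices : ∀ v → v ∈ vertices
  ∈-vertices v = subst (_∈ vertices) (Inverse.strictlyInverseʳ enum v) (∈-tabulate⁺ (index v))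

  length-vertices : length vertices ≡ k
  length-vertices = length-tabulate vertexAt

  decode : Vec V k → V → V
  decode fs v = Vec.lookup fs (index v)

  encode : (V → V) → Vec V k
  encode f = Vec.tabulate (f ∘ vertexAt)

  decode-encode : ∀ f v → f v ≡ decode (encode f) v
  decode-encode f v = sym (trans (Vecₚ.lookup∘tabulate (f ∘ vertexAt) (index v))
                                 (cong f (Inverse.strictlyInverseʳ enum v)))

  module _ (H : Graph V) where

    -- An unpacked automorphism (f with inverse h) fixing S pointwise and moving some
    -- vertex: exactly a witness that S is not a fixing set.
    Violation : List V → (V → V) → (V → V) → Set
    Violation S f h =
      (∀ v → h (f v) ≡ v) × (∀ v → f (h v) ≡ v) × (∀ u v → Adj H (f u) (f v) ≡ Adj H u v)
      × All (λ s → f s ≡ s) S × ∃ (λ v → f v ≢ v)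

    violation? : ∀ S f h → Dec (Violation S f h)
    violation? S f h =
      all-of search-V (λ v → h (f v) ≟ v)
      ×-dec all-of search-V (λ v → f (h v) ≟ v)
      ×-dec all-of search-V (λ u → all-of search-V (λ v → Adj H (f u) (f v) Bool.≟ Adj H u v))
      ×-dec All.all? (λ s → f s ≟ s) S
      ×-dec search-V (λ v → ¬? (f v ≟ v))

    violation-cong : ∀ {S f f′ h h′} → (∀ v → f v ≡ f′ v) → (∀ v → h v ≡ h′ v) →
                     Violation S f h → Violation S f′ h′
    violation-cong {f = f} {f′} {h} {h′} f≗f′ h≗h′ (hf , fh , preserves , fixes-S , v , moves) =
      h′f′ , f′h′ , preserves′ , All.map (λ {s} → trans (sym (f≗f′ s))) fixes-S ,
      v , moves ∘ trans (f≗f′ v)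
      where
      h′f′ : ∀ u → h′ (f′ u) ≡ u
      h′f′ u = begin
        h′ (f′ u) ≡⟨ sym (h≗h′ (f′ u)) ⟩
        h (f′ u)  ≡⟨ cong h (sym (f≗f′ u)) ⟩
        h (f u)   ≡⟨ hf u ⟩
        u         ∎
      f′h′ : ∀ u → f′ (h′ u) ≡ u
      f′h′ u = begin
        f′ (h′ u) ≡⟨ sym (f≗f′ (h′ u)) ⟩
        f (h′ u)  ≡⟨ cong f (sym (h≗h′ u)) ⟩
        f (h u)   ≡⟨ fh u ⟩
        u         ∎
      preserves′ : ∀ u w → Adj H (f′ u) (f′ w) ≡ Adj H u w
      preserves′ u w = trans (sym (cong₂ (Adj H) (f≗f′ u) (f≗f′ w))) (preserves u w)

    violation⇒¬fixing : ∀ {S f h} → Violation S f h → ¬ IsFixingSet H S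
    violation⇒¬fixing {f = f} {h} (hf , fh , preserves , fixes-S , v , moves) fixing =
      moves (fixing σ (λ s s∈S → All.lookup fixes-S s∈S) v)
      where
      σ : Automorphism H
      σ = record { perm = mk↔ₛ′ f h fh hf ; preserve = preserves }

    isFixingSet? : ∀ S → Dec (IsFixingSet H S)
    isFixingSet? S
      with search-Vec search-V k (λ fs → search-Vec search-V k (λ hs →
             violation? S (decode fs) (decode hs)))
    ... | yes (_ , _ , violation) = no (violation⇒¬fixing violation)
    ... | no none = yes fixing
      where
      fixing : IsFixingSet H S
      fixing σ fixes-S v = decidable-stable (σ̂ v ≟ v) λ moves →
        none (encode σ̂ , encode σ⁻¹ ,
              violation-cong (decode-encode σ̂) (decode-encode σ⁻¹)
                (σ⁻¹-σ , σ-σ⁻¹ , preserve σ , All.tabulate (fixes-S _) , v , moves))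
        where open AutomorphismFacts σ

    HasFixingSetOfSize : ℕ → Set
    HasFixingSetOfSize j = ∃ λ S → IsFixingSet H S × length S ≡ j

    as-vector : ∀ {j} → HasFixingSetOfSize j → ∃ λ (ss : Vec V j) → IsFixingSet H (Vec.toList ss)
    as-vector (S , fixing , refl) =
      Vec.fromList S , subst (IsFixingSet H) (sym (Vecₚ.toList∘fromList S)) fixing

    hasFixingSetOfSize? : U.Decidable HasFixingSetOfSize
    hasFixingSetOfSize? j =
      map′ (λ (ss , fixing) → Vec.toList ss , fixing , Vecₚ.length-toList ss) as-vector
           (search-Vec search-V j (isFixingSet? ∘ Vec.toList))

    fixing-number : ∀ S → IsFixingSet H S → ∃ λ k → IsFixingNumber H k × k ≤ length S
    fixing-number S fixing with minimal-witness hasFixingSetOfSize? (length S) (S , fixing , refl)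
    ... | j , smallest , j≤|S| , least =
          j , (smallest , λ S′ fixing′ → least (length S′) (S′ , fixing′ , refl)) , j≤|S|

-- The upper bound fix(F_G) ≤ 2n − 3.  Writing b₁ = g a for the first vertex a of G,
-- a′ for a neighbour of a, b₂ for a neighbour of b₁ and c ∉ {b₁, g a′}, the three
-- vertices x = a, y = b₁ and z = c of F_G are pairwise non-twins:
--   b₂ ∈ B separates a from b₁,  a′ ∈ A separates a from c,  a separates b₁ from c.
module UpperBound {m : ℕ} (G : Graphₙ (3 + m)) (connected : Connected G)
                  (g : Fin (3 + m) → Fin (3 + m)) where

  n : ℕ
  n = 3 + m

  F : Graph (Fin n ⊎ Fin n)
  F = Functigraph G g

  _≟V_ : DecidableEquality (Fin n ⊎ Fin n)
  _≟V_ = Sumₚ.≡-dec Finₚ._≟_ Finₚ._≟_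

  open FiniteGraph _≟V_ (↔-sym +↔⊎)
  open Deletion _≟V_

  -- Every vertex of G has a neighbour: walk to any other vertex.
  neighbour : ∀ u → ∃ λ w → Adj G u w ≡ true
  neighbour u = let (v , v≢u , _) = avoid-two u u in first-step (connected u v) (≢-sym v≢u)

  a a′ b₁ b₂ c : Fin n
  a  = zero
  a′ = proj₁ (neighbour a)
  b₁ = g a
  b₂ = proj₁ (neighbour b₁)
  c  = proj₁ (avoid-two b₁ (g a′))

  a~a′ : Adj G a a′ ≡ true
  a~a′ = proj₂ (neighbour a)

  b₁~b₂ : Adj G b₁ b₂ ≡ true
  b₁~b₂ = proj₂ (neighbour b₁)

  c≢b₁ : c ≢ b₁
  c≢b₁ = proj₁ (proj₂ (avoid-two b₁ (g a′)))

  c≢ga′ : c ≢ g a′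
  c≢ga′ = proj₂ (proj₂ (avoid-two b₁ (g a′)))

  x y z : Fin n ⊎ Fin n
  x = inj₁ a
  y = inj₂ b₁
  z = inj₂ c

  x≢y : x ≢ y
  x≢y ()

  x≢z : x ≢ z
  x≢z ()

  y≢z : y ≢ z
  y≢z = ≢-sym c≢b₁ ∘ inj₂-injective

  x≁y : NonTwins F x y
  x≁y = inj₂ b₂ , (λ ()) , ≢-sym (adjacent-distinct G b₁~b₂) ∘ inj₂-injective ,
        ≢-sym (true≢false-at b₁~b₂ (⌊⌋-no (b₂ Finₚ.≟ b₁) (≢-sym (adjacent-distinct G b₁~b₂))))

  x≁z : NonTwins F x z
  x≁z = inj₁ a′ , ≢-sym (adjacent-distinct G a~a′) ∘ inj₁-injective , (λ ()) ,
        true≢false-at a~a′ (⌊⌋-no (c Finₚ.≟ g a′) c≢ga′)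

  y≁z : NonTwins F y z
  y≁z = inj₁ a , (λ ()) , (λ ()) ,
        true≢false-at (⌊⌋-yes (b₁ Finₚ.≟ g a) refl) (⌊⌋-no (c Finₚ.≟ g a) c≢b₁)

  S₀ : List (Fin n ⊎ Fin n)
  S₀ = vertices without x without y without z

  S₀-fixing : IsFixingSet F S₀
  S₀-fixing σ fixes-S₀ = triple-rigid x≢y y≢z x≢z x≁y x≁z y≁z outside-fixed
    where
    open TripleRigidity _≟V_ σ
    outside-fixed : FixesOutside x y z
    outside-fixed v v≢x v≢y v≢z =
      fixes-S₀ v (∈-without (∈-without (∈-without (∈-vertices v) v≢x) v≢y) v≢z)

  -- The implicit arguments are supplied so that length S₀ is never unfolded.
  |S₀|≤2n-3 : length S₀ ≤ 2 * n ∸ 3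
  |S₀|≤2n-3 = subst (λ t → length S₀ ≤ t ∸ 3) (trans length-vertices n+n≡2n)
    (∸-monoˡ-≤ {m = 3 + length S₀} {n = length vertices} 3 three-fewer)
    where
    three-fewer : 3 + length S₀ ≤ length vertices
    three-fewer = length-without₃ x≢y x≢z y≢z (∈-vertices x) (∈-vertices y) (∈-vertices z)

    n+n≡2n : n + n ≡ 2 * n
    n+n≡2n = cong (n +_) (sym (+-identityʳ n))

  fix-bounded : ∃ λ k → IsFixingNumber F k × 0 ≤ k × k ≤ 2 * n ∸ 3
  fix-bounded =
    let (k , is-fix , k≤|S₀|) = fixing-number F S₀ S₀-fixing
    in k , is-fix , z≤n , ≤-trans {j = length S₀} k≤|S₀| |S₀|≤2n-3

complete : ∀ n → Graphₙ n
complete n = record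
  { Adj    = λ u v → not ⌊ u Finₚ.≟ v ⌋
  ; sym    = λ u v → cong not (⌊≟⌋-sym u v)
  ; irrefl = λ v → cong not (⌊⌋-yes (v Finₚ.≟ v) refl)
  }
  where
  ⌊≟⌋-sym : ∀ (u v : Fin n) → ⌊ u Finₚ.≟ v ⌋ ≡ ⌊ v Finₚ.≟ u ⌋
  ⌊≟⌋-sym u v with u Finₚ.≟ v
  ... | yes u≡v = sym (⌊⌋-yes (v Finₚ.≟ u) (sym u≡v))
  ... | no u≢v  = sym (⌊⌋-no (v Finₚ.≟ u) (≢-sym u≢v))

path : ∀ n → Graphₙ n
path n = record
  { Adj    = λ u v → successor u v ∨ successor v u
  ; sym    = λ u v → Bool.∨-comm (successor u v) (successor v u)
  ; irrefl = λ v → cong₂ _∨_ (not-own-successor v) (not-own-successor v)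
  }
  where
  successor : Fin n → Fin n → Bool
  successor u v = ⌊ toℕ u ℕ.≟ suc (toℕ v) ⌋
  not-own-successor : ∀ v → successor v v ≡ false
  not-own-successor v = ⌊⌋-no (toℕ v ℕ.≟ suc (toℕ v)) (≢-sym 1+n≢n)

pattern a₀ = inj₁ zero
pattern a₁ = inj₁ (suc zero)
pattern a₂ = inj₁ (suc (suc zero))
pattern b₀ = inj₂ zero
pattern b₁ = inj₂ (suc zero)
pattern b₂ = inj₂ (suc (suc zero))

V₃ : Set
V₃ = Fin 3 ⊎ Fin 3

_≟₃_ : DecidableEquality V₃
_≟₃_ = Sumₚ.≡-dec Finₚ._≟_ Finₚ._≟_

-- In F_G the vertex
-- b₂ is the only leaf, so it and its neighbour b₁ are fixed; a₀ is then the only vertex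
-- adjacent to neither; finally a₁, a₂, b₀ are pairwise non-twins.
module RigidExample where

  g : Fin 3 → Fin 3
  g zero             = zero
  g (suc zero)       = suc zero
  g (suc (suc zero)) = suc zero

  F : Graph V₃
  F = Functigraph (path 3) g

  connected : Connected (path 3)
  connected = hub-connected (path 3) (suc zero)
    λ { zero → inj₂ refl ; (suc zero) → inj₁ refl ; (suc (suc zero)) → inj₂ refl }

  b₂-leaf : IsLeafAt F b₂ b₁
  b₂-leaf = refl , λ { a₀ () ; a₁ () ; a₂ () ; b₀ () ; b₁ _ → refl ; b₂ () }

  only-leaf : ∀ u w → IsLeafAt F u w → u ≡ b₂
  only-leaf a₀ _ = ⊥-elim ∘ not-leaf F a₀ {a₁} {b₀} refl refl (λ ())
  only-leaf a₁ _ = ⊥-elim ∘ not-leaf F a₁ {a₀} {b₁} refl refl (λ ())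
  only-leaf a₂ _ = ⊥-elim ∘ not-leaf F a₂ {a₁} {b₁} refl refl (λ ())
  only-leaf b₀ _ = ⊥-elim ∘ not-leaf F b₀ {a₀} {b₁} refl refl (λ ())
  only-leaf b₁ _ = ⊥-elim ∘ not-leaf F b₁ {b₀} {b₂} refl refl (λ ())
  only-leaf b₂ _ _ = refl

  a₀-determined : ∀ w → w ∉ b₂ ∷ b₁ ∷ [] →
                  All (λ x → Adj F w x ≡ Adj F a₀ x) (b₂ ∷ b₁ ∷ []) → w ≡ a₀
  a₀-determined a₀ _   _               = refl
  a₀-determined a₁ _   (_ ∷ () ∷ [])
  a₀-determined a₂ _   (_ ∷ () ∷ [])
  a₀-determined b₀ _   (_ ∷ () ∷ [])
  a₀-determined b₁ b₁∉ _               = ⊥-elim (b₁∉ (there (here refl)))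
  a₀-determined b₂ b₂∉ _               = ⊥-elim (b₂∉ (here refl))

  rigid : IsFixingSet F []
  rigid σ _ = triple-rigid {a₁} {a₂} {b₀} (λ ()) (λ ()) (λ ())
                (a₀ , (λ ()) , (λ ()) , λ ()) (a₂ , (λ ()) , (λ ()) , λ ())
                (a₀ , (λ ()) , (λ ()) , λ ()) fixes-outside
    where
    open AutomorphismFacts σ
    open TripleRigidity _≟₃_ σ

    σb₂≡b₂ = proj₁ (unique-leaf-fixed b₂-leaf only-leaf)
    σb₁≡b₁ = proj₂ (unique-leaf-fixed b₂-leaf only-leaf)

    σa₀≡a₀ : σ̂ a₀ ≡ a₀
    σa₀≡a₀ = determined-fixed (b₂ ∷ b₁ ∷ [])
      (λ { (here refl) → σb₂≡b₂ ; (there (here refl)) → σb₁≡b₁ })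
      (λ { (here ()) ; (there (here ())) ; (there (there ())) })
      a₀-determined

    fixes-outside : FixesOutside a₁ a₂ b₀
    fixes-outside a₀ _ _ _ = σa₀≡a₀
    fixes-outside a₁ v≢a₁ _ _ = ⊥-elim (v≢a₁ refl)
    fixes-outside a₂ _ v≢a₂ _ = ⊥-elim (v≢a₂ refl)
    fixes-outside b₀ _ _ v≢b₀ = ⊥-elim (v≢b₀ refl)
    fixes-outside b₁ _ _ _ = σb₁≡b₁
    fixes-outside b₂ _ _ _ = σb₂≡b₂

  fix-zero : IsFixingNumber F 0
  fix-zero = ([] , rigid , refl) , λ _ _ → z≤n

-- fix(F_G) = 3 = 2·3 − 3 for the triangle with constant g = 0.  The vertices a₀, a₁, a₂
-- are pairwise twins and so are b₁, b₂, so every fixing set contains two of the aᵢ and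
-- one of b₁, b₂; the general upper bound supplies the matching fixing set.
module ExtremalExample where

  g : Fin 3 → Fin 3
  g _ = zero

  F : Graph V₃
  F = Functigraph (complete 3) g

  connected : Connected (complete 3)
  connected = hub-connected (complete 3) zero
    λ { zero → inj₁ refl ; (suc zero) → inj₂ refl ; (suc (suc zero)) → inj₂ refl }

  open Deletion _≟₃_

  a₀≈a₁ : Twins F a₀ a₁
  a₀≈a₁ = λ { a₀ w≢ _ → ⊥-elim (w≢ refl) ; a₁ _ w≢ → ⊥-elim (w≢ refl)
            ; a₂ _ _ → refl ; b₀ _ _ → refl ; b₁ _ _ → refl ; b₂ _ _ → refl }

  a₀≈a₂ : Twins F a₀ a₂
  a₀≈a₂ = λ { a₀ w≢ _ → ⊥-elim (w≢ refl) ; a₂ _ w≢ → ⊥-elim (w≢ refl)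
            ; a₁ _ _ → refl ; b₀ _ _ → refl ; b₁ _ _ → refl ; b₂ _ _ → refl }

  a₁≈a₂ : Twins F a₁ a₂
  a₁≈a₂ = λ { a₁ w≢ _ → ⊥-elim (w≢ refl) ; a₂ _ w≢ → ⊥-elim (w≢ refl)
            ; a₀ _ _ → refl ; b₀ _ _ → refl ; b₁ _ _ → refl ; b₂ _ _ → refl }

  b₁≈b₂ : Twins F b₁ b₂
  b₁≈b₂ = λ { b₁ w≢ _ → ⊥-elim (w≢ refl) ; b₂ _ w≢ → ⊥-elim (w≢ refl)
            ; a₀ _ _ → refl ; a₁ _ _ → refl ; a₂ _ _ → refl ; b₀ _ _ → refl }

  two-of-A : ∀ {S : List V₃} → a₀ ∈ S ⊎ a₁ ∈ S → a₀ ∈ S ⊎ a₂ ∈ S → a₁ ∈ S ⊎ a₂ ∈ S →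
             ∃ λ (i : Fin 3) → ∃ λ j → i ≢ j × inj₁ i ∈ S × inj₁ j ∈ S
  two-of-A (inj₁ a₀∈S) _           (inj₁ a₁∈S) = _ , _ , (λ ()) , a₀∈S , a₁∈S
  two-of-A (inj₁ a₀∈S) _           (inj₂ a₂∈S) = _ , _ , (λ ()) , a₀∈S , a₂∈S
  two-of-A (inj₂ a₁∈S) (inj₁ a₀∈S) _           = _ , _ , (λ ()) , a₀∈S , a₁∈S
  two-of-A (inj₂ a₁∈S) (inj₂ a₂∈S) _           = _ , _ , (λ ()) , a₁∈S , a₂∈S

  meets : ∀ {S : List V₃} {p q} → IsFixingSet F S → p ≢ q → Twins F p q → p ∈ S ⊎ q ∈ S
  meets fixing p≢q twins = TwinTransposition.fixing-set-meets-twins _≟₃_ F p≢q twins fixing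

  one-of-B : ∀ {S : List V₃} → b₁ ∈ S ⊎ b₂ ∈ S → ∃ λ (b : Fin 3) → inj₂ b ∈ S
  one-of-B (inj₁ b₁∈S) = _ , b₁∈S
  one-of-B (inj₂ b₂∈S) = _ , b₂∈S

  three-distinct : ∀ {S : List V₃} → (∃ λ (i : Fin 3) → ∃ λ j → i ≢ j × inj₁ i ∈ S × inj₁ j ∈ S) →
                   (∃ λ (b : Fin 3) → inj₂ b ∈ S) → 3 ≤ length S
  three-distinct (i , j , i≢j , i∈S , j∈S) (b , b∈S) =
    ≤-trans (m≤m+n 3 _) (length-without₃ (i≢j ∘ inj₁-injective) (λ ()) (λ ()) i∈S j∈S b∈S)

  at-least-three : ∀ S → IsFixingSet F S → 3 ≤ length S
  at-least-three S fixing = three-distinct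
    (two-of-A (meets fixing (λ ()) a₀≈a₁) (meets fixing (λ ()) a₀≈a₂) (meets fixing (λ ()) a₁≈a₂))
    (one-of-B (meets fixing (λ ()) b₁≈b₂))

  -- The general upper bound gives a fixing number k ≤ 3, and k is the size of a fixing set.
  fix-three : IsFixingNumber F 3
  fix-three = exactly-three (UpperBound.fix-bounded (complete 3) connected g)
    where
    exactly-three : (∃ λ k → IsFixingNumber F k × 0 ≤ k × k ≤ 3) → IsFixingNumber F 3
    exactly-three (k , is-fix@((S , fixing , |S|≡k) , _) , _ , k≤3) =
      subst (IsFixingNumber F) (≤-antisym k≤3 (subst (3 ≤_) |S|≡k (at-least-three S fixing))) is-fix

upper-bound : (n : ℕ) → 3 ≤ n → (G : Graphₙ n) → Connected G → (g : Fin n → Fin n) →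
              Σ ℕ (λ k → IsFixingNumber (Functigraph G g) k × 0 ≤ k × k ≤ 2 * n ∸ 3)
upper-bound (suc (suc (suc m))) (s≤s (s≤s (s≤s z≤n))) = UpperBound.fix-bounded

mainTheorem1 : ((n : ℕ) → 3 ≤ n → (G : Graphₙ n) → Connected G → (g : Fin n → Fin n) →
      Σ ℕ (λ k → IsFixingNumber (Functigraph G g) k × 0 ≤ k × k ≤ 2 * n ∸ 3))
    × Σ ℕ (λ n → 3 ≤ n × Σ (Graphₙ n) (λ G → Connected G × Σ (Fin n → Fin n) (λ g →
        IsFixingNumber (Functigraph G g) 0)))
    × Σ ℕ (λ n → 3 ≤ n × Σ (Graphₙ n) (λ G → Connected G × Σ (Fin n → Fin n) (λ g →
        IsFixingNumber (Functigraph G g) (2 * n ∸ 3))))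
mainTheorem1 =
    upper-bound
  , (3 , 3≤3 , path 3 , RigidExample.connected , RigidExample.g , RigidExample.fix-zero)
  , (3 , 3≤3 , complete 3 , ExtremalExample.connected , ExtremalExample.g , ExtremalExample.fix-three)
  where
  3≤3 : 3 ≤ 3
  3≤3 = ≤-refl
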